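{- Let $A$ be an MV-algebra with lattice spectrum $X$ and partial operation $+$ as defined in the context. Then for all $x,x',x''\in X$: 1. (Commutativity) if $x+x'$ is defined then $x'+x$ is defined and $x+x'=x'+x$; 2. (Associativity) if $x+x'$ and $(x+x')+x''$ are defined, then $x+(x'+x'')$ is defined and $(x+x')+x''=x+(x'+x'')$; 3. (Translation invariance) if $x'\le x''$ and $x+x''$ is defined, then $x+x'$ is defined and $x+x'\le x+x''$; 4. $I_x$ is a prime MV-ideal if and only if $x+x$ is defined and $x+x=x$; hence $Y=\{y\in X:(y,y)\in\mathrm{dom}(+),\ y+y\le y\}=\{y\in X:(y,y)\in\mathrm{dom}(+),\ y+y=y\}$, and $Y$ is closed in $(X,\tau^p)$; 5. (Continuity) $+\colon\mathrm{dom}(+)\to X$ is continuous when $X$ carries $\tau^\uparrow$ and $\mathrm{dom}(+)$ carries the subspace topology of $(X,\tau^\uparrow)\times(X,\tau^\uparrow)$; 6. $\mathrm{dom}(+)$ is closed in $(X,\tau^\uparrow)\times(X,\tau^\uparrow)$.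
   Context: An MV-algebra is $(A,\oplus,\neg,0)$ with $(A,\oplus,0)$ a commutative monoid, $\neg\neg x=x$, $x\oplus\neg0=\neg0$, and $\neg(\neg x\oplus y)\oplus y=\neg(\neg y\oplus x)\oplus x$. Put $1:=\neg 0$, $x\ominus y:=\neg(\neg x\oplus y)$; $A$ is a bounded distributive lattice under $x\vee y:=\neg(\neg x\oplus y)\oplus y$, $x\wedge y:=\neg(\neg x\vee\neg y)$. An MV-ideal is a downset containing $0$ and closed under $\oplus$; it is prime if it is proper and for all $a,b$ either $a\ominus b$ or $b\ominus a$ belongs to it. $X$ is the set of prime lattice ideals of the lattice reduct of $A$; for $x\in X$, $I_x$ is the ideal of $x$; $x\le x'$ iff $I_x\subseteq I_{x'}$; $\hat a:=\{x:a\notin I_x\}$; $\tau^\uparrow$ is the topology with basis $\{X\setminus\hat a: a\in A\}$, $\tau^p$ the topology generated by the sets $\hat a$ and $X\setminus \hat a$. $Y:=\{x\in X: I_x$ is a prime MV-ideal$\}$. For lattice ideals $I,J$ put $I\,\overline{\oplus}\,J:=\{c\in A:\exists a\in I,b\in J,\ c\le a\oplus b\}$. $\mathrm{dom}(+):=\{(x,x')\in X^2: 1\notin I_x\,\overline{\oplus}\,I_{x'}\}$; for such pairs $I_x\,\overline{\oplus}\,I_{x'}$ is a prime lattice ideal and $x+x'$ denotes the point with $I_{x+x'}=I_x\,\overline{\oplus}\,I_{x'}$. -}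

module Defs where

open import Level using (Level; suc; _⊔_)
open import Data.Product using (Σ; ∃; ∃₂; _×_; _,_; proj₁; proj₂)
open import Data.Sum using (_⊎_)
open import Data.Bool using (Bool; true; false)
open import Data.List using (List)
open import Data.List.Relation.Unary.All using (All)
open import Relation.Nullary using (¬_)
open import Relation.Unary using (Pred; _⊆_; _≐_; ∁)
open import Relation.Binary.PropositionalEquality using (_≡_)
open import Function.Bundles using (_⇔_)

-- MV-algebra (A, ⊕, ∼, 𝟘); ∼ is the MV negation ¬ of the paper.
record MVAlgebra (ℓ : Level) : Set (suc ℓ) where
  infixl 6 _⊕_
  infix 8 ∼_
  field
    Carrier     : Set ℓ
    _⊕_         : Carrier → Carrier → Carrier
    ∼_          : Carrier → Carrier
    𝟘           : Carrier
    ⊕-assoc     : ∀ x y z → (x ⊕ y) ⊕ z ≡ x ⊕ (y ⊕ z)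
    ⊕-comm      : ∀ x y → x ⊕ y ≡ y ⊕ x
    ⊕-identityˡ : ∀ x → 𝟘 ⊕ x ≡ x
    ⊕-identityʳ : ∀ x → x ⊕ 𝟘 ≡ x
    ∼∼          : ∀ x → ∼ (∼ x) ≡ x
    ⊕-absorb    : ∀ x → x ⊕ ∼ 𝟘 ≡ ∼ 𝟘
    łuk         : ∀ x y → ∼ (∼ x ⊕ y) ⊕ y ≡ ∼ (∼ y ⊕ x) ⊕ x

module MVTheory {ℓ : Level} (A : MVAlgebra ℓ) where
  open MVAlgebra A public

  infixl 6 _⊖_
  infixl 5 _∨_
  infixl 5 _∧_
  infix 4 _≤_

  𝟙 : Carrier
  𝟙 = ∼ 𝟘

  _⊖_ : Carrier → Carrier → Carrier
  x ⊖ y = ∼ (∼ x ⊕ y)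

  _∨_ : Carrier → Carrier → Carrier
  x ∨ y = ∼ (∼ x ⊕ y) ⊕ y

  _∧_ : Carrier → Carrier → Carrier
  x ∧ y = ∼ (∼ x ∨ ∼ y)

  _≤_ : Carrier → Carrier → Set ℓ
  x ≤ y = x ∨ y ≡ y

  record IsPrimeLatticeIdeal (I : Pred Carrier ℓ) : Set ℓ where
    field
      zero∈    : I 𝟘
      downward : ∀ {a b} → I b → a ≤ b → I a
      ∨-closed : ∀ {a b} → I a → I b → I (a ∨ b)
      proper   : ¬ (∀ a → I a)
      prime    : ∀ {a b} → I (a ∧ b) → I a ⊎ I b

  record IsMVIdeal (I : Pred Carrier ℓ) : Set ℓ where
    field
      zero∈    : I 𝟘
      downward : ∀ {a b} → I b → a ≤ b → I a
      ⊕-closed : ∀ {a b} → I a → I b → I (a ⊕ b)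

  record IsPrimeMVIdeal (I : Pred Carrier ℓ) : Set ℓ where
    field
      isMVIdeal : IsMVIdeal I
      proper    : ¬ (∀ a → I a)
      prime     : ∀ a b → I (a ⊖ b) ⊎ I (b ⊖ a)

  -- points of the lattice spectrum X; a point is identified with its ideal I_x,
  -- so equality of points is extensional equality (≐) of their ideals and
  -- x ≤ x' is I_x ⊆ I_x'.
  record Pt : Set (suc ℓ) where
    field
      I     : Pred Carrier ℓ
      prime : IsPrimeLatticeIdeal I
  open Pt public

  _⊕̄_ : Pred Carrier ℓ → Pred Carrier ℓ → Pred Carrier ℓ
  (I ⊕̄ J) c = ∃₂ λ a b → I a × J b × c ≤ a ⊕ b

  -- (x , x') ∈ dom(+)   (then I_{x+x'} = I_x ⊕̄ I_x')
  Dom : Pt → Pt → Set ℓ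
  Dom x x' = ¬ ((I x ⊕̄ I x') 𝟙)

  DomP : Pred (Pt × Pt) ℓ
  DomP p = Dom (proj₁ p) (proj₂ p)

  hat : Carrier → Pred Pt ℓ
  hat a x = ¬ I x a

  Y : Pred Pt ℓ
  Y x = IsPrimeMVIdeal (I x)

  IsOpen↑ : ∀ {ℓ'} → Pred Pt ℓ' → Set (suc ℓ ⊔ ℓ')
  IsOpen↑ U = ∀ x → U x → ∃ λ a → ∁ (hat a) x × (∁ (hat a) ⊆ U)

  -- τ^p : topology generated by the subbasis { â } ∪ { X ∖ â }
  -- (true , a) codes â, (false , a) codes X ∖ â; opens are unions of finite intersections
  subᵖ : Bool × Carrier → Pred Pt ℓ
  subᵖ (true  , a) = hat a
  subᵖ (false , a) = ∁ (hat a)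

  IsOpenᵖ : ∀ {ℓ'} → Pred Pt ℓ' → Set (suc ℓ ⊔ ℓ')
  IsOpenᵖ U = ∀ x → U x → ∃ λ (L : List (Bool × Carrier)) →
                All (λ s → subᵖ s x) L × (∀ y → All (λ s → subᵖ s y) L → U y)

  IsClosedᵖ : ∀ {ℓ'} → Pred Pt ℓ' → Set (suc ℓ ⊔ ℓ')
  IsClosedᵖ C = IsOpenᵖ (∁ C)

  IsOpen↑² : ∀ {ℓ'} → Pred (Pt × Pt) ℓ' → Set (suc ℓ ⊔ ℓ')
  IsOpen↑² W = ∀ p → W p → Σ (Pred Pt ℓ) λ U → Σ (Pred Pt ℓ) λ V →
                 IsOpen↑ U × IsOpen↑ V × U (proj₁ p) × V (proj₂ p) ×
                 (∀ y y' → U y → V y' → W (y , y'))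

  IsClosed↑² : ∀ {ℓ'} → Pred (Pt × Pt) ℓ' → Set (suc ℓ ⊔ ℓ')
  IsClosed↑² C = IsOpen↑² (∁ C)

  IsOpenInDom : Pred (Pt × Pt) (suc ℓ) → Set (suc (suc ℓ))
  IsOpenInDom O = Σ (Pred (Pt × Pt) (suc ℓ)) λ W →
                    IsOpen↑² W × (∀ p → DomP p → (O p ⇔ W p))

  +⁻¹ : Pred Pt ℓ → Pred (Pt × Pt) (suc ℓ)
  +⁻¹ U p = DomP p × ∃ λ (z : Pt) → (I z ≐ (I (proj₁ p) ⊕̄ I (proj₂ p))) × U z

-- The lattice order of an MV-algebra satisfies x ≤ y ⇔ ∼ x ⊕ y = 1, and with this
-- description prelinearity (∼ a ⊕ b) ∨ (∼ b ⊕ a) = 1 yields the distributivity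
-- inequality x ⊕ (y ∨ z) ≤ (x ⊕ y) ∨ (x ⊕ z).  From it, c ∧ d ≤ a ⊕ b gives
-- (c ⊖ a) ∧ (d ⊖ a) ≤ b, so the ⊕̄-sum of two prime lattice ideals is again prime
-- whenever it is proper.  A prime lattice ideal is a prime MV-ideal exactly when it is
-- closed under ⊕, because (a ⊖ b) ∧ (b ⊖ a) = 0.  For the topology, c ∈ I_y ⊕̄ I_y'
-- is witnessed by a ∈ I_y and b ∈ I_y', which persists on the basic open
-- neighbourhood (X ∖ â) × (X ∖ b̂); excluded middle is needed to read membership
-- I_y a back from the doubly negated condition y ∉ â.
module Submission where

open import Defs
open import Level using (Level)
open import Algebra.Bundles using (CommutativeSemigroup)
open import Axiom.ExcludedMiddle using (ExcludedMiddle)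
open import Axiom.DoubleNegationElimination using (em⇒dne)
open import Data.Bool using (true; false)
open import Data.Empty using (⊥-elim)
open import Data.List using (_∷_; [])
open import Data.List.Relation.Unary.All using (_∷_; [])
open import Data.Product using (Σ; ∃; ∃₂; _×_; _,_; proj₁; proj₂)
open import Data.Sum using (_⊎_; inj₁; inj₂)
open import Function using (id)
open import Function.Bundles using (_⇔_; mk⇔)
open import Relation.Nullary using (¬_; yes; no)
open import Relation.Unary using (Pred; _⊆_; _≐_; ∁)
open import Relation.Unary.Properties using (≐-refl)
open import Relation.Binary.PropositionalEquality

module MVProperties {ℓ : Level} (A : MVAlgebra ℓ) where
  open MVTheory A
  open ≡-Reasoning

  ⊕-commutativeSemigroup : CommutativeSemigroup ℓ ℓ
  ⊕-commutativeSemigroup = record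
    { isCommutativeSemigroup = record
      { isSemigroup = record
        { isMagma = record { isEquivalence = isEquivalence ; ∙-cong = cong₂ _⊕_ }
        ; assoc   = ⊕-assoc }
      ; comm = ⊕-comm } }

  open import Algebra.Properties.CommutativeSemigroup ⊕-commutativeSemigroup
    using (x∙yz≈y∙xz; x∙yz≈xz∙y)

  infix 4 _≼_
  _≼_ : Carrier → Carrier → Set ℓ
  x ≼ y = ∼ x ⊕ y ≡ 𝟙

  ∼𝟙≡𝟘 : ∼ 𝟙 ≡ 𝟘
  ∼𝟙≡𝟘 = ∼∼ 𝟘

  ⊕-zeroˡ : ∀ x → 𝟙 ⊕ x ≡ 𝟙
  ⊕-zeroˡ x = trans (⊕-comm 𝟙 x) (⊕-absorb x)

  ∼𝟙⊕x≡x : ∀ x → ∼ 𝟙 ⊕ x ≡ x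
  ∼𝟙⊕x≡x x = trans (cong (_⊕ x) ∼𝟙≡𝟘) (⊕-identityˡ x)

  ⊕-inverseˡ : ∀ x → ∼ x ⊕ x ≡ 𝟙
  ⊕-inverseˡ x = begin
    ∼ x ⊕ x                ≡⟨ cong (λ t → ∼ t ⊕ x) (∼𝟙⊕x≡x x) ⟨
    ∼ (∼ 𝟙 ⊕ x) ⊕ x        ≡⟨ łuk x 𝟙 ⟨
    ∼ (∼ x ⊕ 𝟙) ⊕ 𝟙        ≡⟨ ⊕-absorb _ ⟩
    𝟙                      ∎

  ⊕-inverseʳ : ∀ x → x ⊕ ∼ x ≡ 𝟙
  ⊕-inverseʳ x = trans (⊕-comm x (∼ x)) (⊕-inverseˡ x)

  ≼⇒≤ : ∀ {x y} → x ≼ y → x ≤ y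
  ≼⇒≤ {x} {y} x≼y = trans (cong (λ t → ∼ t ⊕ y) x≼y) (∼𝟙⊕x≡x y)

  ≤⇒≼ : ∀ {x y} → x ≤ y → x ≼ y
  ≤⇒≼ {x} {y} x≤y = begin
    ∼ x ⊕ y                      ≡⟨ cong (∼ x ⊕_) x≤y ⟨
    ∼ x ⊕ (∼ (∼ x ⊕ y) ⊕ y)      ≡⟨ cong (∼ x ⊕_) (⊕-comm _ y) ⟩
    ∼ x ⊕ (y ⊕ ∼ (∼ x ⊕ y))      ≡⟨ ⊕-assoc _ _ _ ⟨
    (∼ x ⊕ y) ⊕ ∼ (∼ x ⊕ y)      ≡⟨ ⊕-inverseʳ _ ⟩
    𝟙                            ∎

  ≤-refl : ∀ x → x ≤ x
  ≤-refl x = ≼⇒≤ (⊕-inverseˡ x)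

  ≼⇒≡⊕⊖ : ∀ {x y} → x ≼ y → y ≡ x ⊕ (y ⊖ x)
  ≼⇒≡⊕⊖ {x} {y} x≼y = sym (trans (⊕-comm x _) (trans (sym (łuk x y)) (≼⇒≤ x≼y)))

  ≡⊕⇒≼ : ∀ {x y} z → y ≡ x ⊕ z → x ≼ y
  ≡⊕⇒≼ {x} {y} z y≡x⊕z = begin
    ∼ x ⊕ y          ≡⟨ cong (∼ x ⊕_) y≡x⊕z ⟩
    ∼ x ⊕ (x ⊕ z)    ≡⟨ ⊕-assoc _ _ _ ⟨
    (∼ x ⊕ x) ⊕ z    ≡⟨ cong (_⊕ z) (⊕-inverseˡ x) ⟩
    𝟙 ⊕ z            ≡⟨ ⊕-zeroˡ z ⟩
    𝟙                ∎

  𝟘≼ : ∀ x → 𝟘 ≼ x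
  𝟘≼ = ⊕-zeroˡ

  ≼𝟙 : ∀ x → x ≼ 𝟙
  ≼𝟙 x = ⊕-absorb (∼ x)

  𝟙≼⇒≡𝟙 : ∀ {x} → 𝟙 ≼ x → x ≡ 𝟙
  𝟙≼⇒≡𝟙 {x} 𝟙≼x = trans (sym (∼𝟙⊕x≡x x)) 𝟙≼x

  ≼-trans : ∀ {x y z} → x ≼ y → y ≼ z → x ≼ z
  ≼-trans {x} {y} {z} x≼y y≼z = ≡⊕⇒≼ ((y ⊖ x) ⊕ (z ⊖ y)) (begin
    z                          ≡⟨ ≼⇒≡⊕⊖ y≼z ⟩
    y ⊕ (z ⊖ y)                ≡⟨ cong (_⊕ (z ⊖ y)) (≼⇒≡⊕⊖ x≼y) ⟩
    (x ⊕ (y ⊖ x)) ⊕ (z ⊖ y)    ≡⟨ ⊕-assoc _ _ _ ⟩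
    x ⊕ ((y ⊖ x) ⊕ (z ⊖ y))    ∎)

  ≤-trans : ∀ {x y z} → x ≤ y → y ≤ z → x ≤ z
  ≤-trans x≤y y≤z = ≼⇒≤ (≼-trans (≤⇒≼ x≤y) (≤⇒≼ y≤z))

  ⊕-monoˡ-≼ : ∀ {x y} z → x ≼ y → x ⊕ z ≼ y ⊕ z
  ⊕-monoˡ-≼ {x} {y} z x≼y = ≡⊕⇒≼ (y ⊖ x) (begin
    y ⊕ z                ≡⟨ cong (_⊕ z) (≼⇒≡⊕⊖ x≼y) ⟩
    (x ⊕ (y ⊖ x)) ⊕ z    ≡⟨ ⊕-assoc _ _ _ ⟩
    x ⊕ ((y ⊖ x) ⊕ z)    ≡⟨ x∙yz≈xz∙y x _ z ⟩
    (x ⊕ z) ⊕ (y ⊖ x)    ∎)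

  ⊕-monoʳ-≼ : ∀ {x y} z → x ≼ y → z ⊕ x ≼ z ⊕ y
  ⊕-monoʳ-≼ {x} {y} z x≼y = subst₂ _≼_ (⊕-comm x z) (⊕-comm y z) (⊕-monoˡ-≼ z x≼y)

  ⊕-mono-≼ : ∀ {x x' y y'} → x ≼ x' → y ≼ y' → x ⊕ y ≼ x' ⊕ y'
  ⊕-mono-≼ {x' = x'} {y} x≼x' y≼y' = ≼-trans (⊕-monoˡ-≼ y x≼x') (⊕-monoʳ-≼ x' y≼y')

  ⊕-monoʳ-≤ : ∀ {x y} z → x ≤ y → z ⊕ x ≤ z ⊕ y
  ⊕-monoʳ-≤ z x≤y = ≼⇒≤ (⊕-monoʳ-≼ z (≤⇒≼ x≤y))

  ⊕-monoˡ-≤ : ∀ {x y} z → x ≤ y → x ⊕ z ≤ y ⊕ z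
  ⊕-monoˡ-≤ z x≤y = ≼⇒≤ (⊕-monoˡ-≼ z (≤⇒≼ x≤y))

  x≼x∨y : ∀ x y → x ≼ x ∨ y
  x≼x∨y x y = ≡⊕⇒≼ _ (trans (łuk x y) (⊕-comm _ x))

  y≼x∨y : ∀ x y → y ≼ x ∨ y
  y≼x∨y x y = ≡⊕⇒≼ _ (⊕-comm _ y)

  ∼∨⊕y≡∼⊕y : ∀ x y → ∼ (x ∨ y) ⊕ y ≡ ∼ x ⊕ y
  ∼∨⊕y≡∼⊕y x y = begin
    ∼ (∼ w ⊕ y) ⊕ y    ≡⟨ łuk w y ⟩
    ∼ (∼ y ⊕ w) ⊕ w    ≡⟨ cong (λ t → ∼ t ⊕ w) y≼w ⟩
    ∼ 𝟙 ⊕ w            ≡⟨ ∼𝟙⊕x≡x w ⟩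
    w                  ∎
    where
    w = ∼ x ⊕ y
    y≼w : y ≼ w
    y≼w = trans (x∙yz≈y∙xz (∼ y) (∼ x) y)
                (trans (cong (∼ x ⊕_) (⊕-inverseˡ y)) (⊕-absorb _))

  ∨-lub : ∀ {x y z} → x ≼ z → y ≼ z → x ∨ y ≼ z
  ∨-lub {x} {y} {z} x≼z y≼z = begin
    ∼ (x ∨ y) ⊕ z                  ≡⟨ cong (∼ (x ∨ y) ⊕_) z≡ ⟩
    ∼ (x ∨ y) ⊕ (y ⊕ (z ⊖ y))      ≡⟨ ⊕-assoc _ _ _ ⟨
    (∼ (x ∨ y) ⊕ y) ⊕ (z ⊖ y)      ≡⟨ cong (_⊕ (z ⊖ y)) (∼∨⊕y≡∼⊕y x y) ⟩
    (∼ x ⊕ y) ⊕ (z ⊖ y)            ≡⟨ ⊕-assoc _ _ _ ⟩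
    ∼ x ⊕ (y ⊕ (z ⊖ y))            ≡⟨ cong (∼ x ⊕_) z≡ ⟨
    ∼ x ⊕ z                        ≡⟨ x≼z ⟩
    𝟙                              ∎
    where z≡ = ≼⇒≡⊕⊖ y≼z

  y≼x⇒x∨y≡x : ∀ {x y} → y ≼ x → x ∨ y ≡ x
  y≼x⇒x∨y≡x {x} y≼x = trans (łuk x _) (trans (cong (λ t → ∼ t ⊕ x) y≼x) (∼𝟙⊕x≡x x))

  ∼-antitone : ∀ {x y} → x ≼ y → ∼ y ≼ ∼ x
  ∼-antitone {x} {y} x≼y = trans (cong (_⊕ ∼ x) (∼∼ y)) (trans (⊕-comm y (∼ x)) x≼y)

  x≼y⇒x∧y≡x : ∀ {x y} → x ≼ y → x ∧ y ≡ x
  x≼y⇒x∧y≡x {x} x≼y = trans (cong ∼_ (y≼x⇒x∨y≡x (∼-antitone x≼y))) (∼∼ x)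

  ⊕∨⊕ : ∀ x y z → (x ⊕ y) ∨ (x ⊕ z) ≡ x ⊕ (y ∨ (z ∧ ∼ x))
  ⊕∨⊕ x y z = begin
    (x ⊕ y) ∨ (x ⊕ z)                        ≡⟨ łuk (x ⊕ y) (x ⊕ z) ⟩
    ∼ (∼ (x ⊕ z) ⊕ (x ⊕ y)) ⊕ (x ⊕ y)        ≡⟨ cong (λ t → ∼ t ⊕ (x ⊕ y)) (⊕-assoc _ x y) ⟨
    ∼ ((∼ (x ⊕ z) ⊕ x) ⊕ y) ⊕ (x ⊕ y)        ≡⟨ cong (λ t → ∼ (t ⊕ y) ⊕ (x ⊕ y)) ∼t≡ ⟨
    ∼ (∼ t ⊕ y) ⊕ (x ⊕ y)                    ≡⟨ x∙yz≈y∙xz _ x y ⟩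
    x ⊕ (∼ (∼ t ⊕ y) ⊕ y)                    ≡⟨ cong (x ⊕_) (łuk y t) ⟨
    x ⊕ (y ∨ t)                              ∎
    where
    t = z ∧ ∼ x
    ∼t≡ : ∼ t ≡ ∼ (x ⊕ z) ⊕ x
    ∼t≡ = trans (∼∼ _) (trans (cong₂ (λ u v → ∼ (u ⊕ v) ⊕ v) (∼∼ z) (∼∼ x))
                              (cong (λ u → ∼ u ⊕ x) (⊕-comm z x)))

  -- With m = a ∨ b, both disjuncts become ∼ m ⊕ _, and ⊕∨⊕ pulls ∼ m out.
  prelinearity : ∀ a b → (∼ a ⊕ b) ∨ (∼ b ⊕ a) ≡ 𝟙
  prelinearity a b = begin
    (∼ a ⊕ b) ∨ (∼ b ⊕ a)      ≡⟨ cong₂ _∨_ (sym (∼∨⊕y≡∼⊕y a b)) ∼b⊕a ⟩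
    (∼ m ⊕ b) ∨ (∼ m ⊕ a)      ≡⟨ ⊕∨⊕ (∼ m) b a ⟩
    ∼ m ⊕ (b ∨ (a ∧ ∼ ∼ m))    ≡⟨ cong (λ u → ∼ m ⊕ (b ∨ u)) a∧∼∼m ⟩
    ∼ m ⊕ (b ∨ a)              ≡⟨ cong (∼ m ⊕_) (łuk b a) ⟩
    ∼ m ⊕ m                    ≡⟨ ⊕-inverseˡ m ⟩
    𝟙                          ∎
    where
    m = a ∨ b
    ∼b⊕a : ∼ b ⊕ a ≡ ∼ m ⊕ a
    ∼b⊕a = trans (sym (∼∨⊕y≡∼⊕y b a)) (cong (λ t → ∼ t ⊕ a) (łuk b a))
    a∧∼∼m : a ∧ ∼ ∼ m ≡ a
    a∧∼∼m = trans (cong (a ∧_) (∼∼ m)) (x≼y⇒x∧y≡x (x≼x∨y a b))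

  -- As u ∨ v = (u ⊖ v) ⊕ v, S = (u ⊖ v) ⊕ (x ⊕ v) for (u , v) = (y , z), (z , y); so both
  -- ∼ y ⊕ z and ∼ z ⊕ y lie below ∼ S ⊕ R, hence so does their join, which is 𝟙.
  ⊕-distribˡ-∨-≼ : ∀ x y z → x ⊕ (y ∨ z) ≼ (x ⊕ y) ∨ (x ⊕ z)
  ⊕-distribˡ-∨-≼ x y z =
    𝟙≼⇒≡𝟙 (subst (_≼ ∼ S ⊕ R) (prelinearity y z)
                  (∨-lub (below y z (y≼x∨y _ _) refl) (below z y (x≼x∨y _ _) (cong (x ⊕_) (łuk y z)))))
    where
    S = x ⊕ (y ∨ z)
    R = (x ⊕ y) ∨ (x ⊕ z)
    below : ∀ u v → x ⊕ v ≼ R → S ≡ x ⊕ (u ∨ v) → ∼ u ⊕ v ≼ ∼ S ⊕ R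
    below u v x⊕v≼R S≡ = trans (x∙yz≈y∙xz (∼ (∼ u ⊕ v)) (∼ S) R)
      (subst (_≼ (u ⊖ v) ⊕ R) (sym (trans S≡ (sym (x∙yz≈y∙xz (u ⊖ v) x v))))
             (⊕-monoʳ-≼ (u ⊖ v) x⊕v≼R))

  ∧≼⊕⇒∧⊖≼ : ∀ a b c d → c ∧ d ≼ a ⊕ b → (c ⊖ a) ∧ (d ⊖ a) ≼ b
  ∧≼⊕⇒∧⊖≼ a b c d c∧d≼a⊕b = begin
    ∼ ((c ⊖ a) ∧ (d ⊖ a)) ⊕ b      ≡⟨ cong (_⊕ b) ∼∧≡ ⟩
    ((a ⊕ ∼ c) ∨ (a ⊕ ∼ d)) ⊕ b    ≡⟨ 𝟙≼⇒≡𝟙 𝟙≼ ⟩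
    𝟙                              ∎
    where
    ∼∧≡ : ∼ ((c ⊖ a) ∧ (d ⊖ a)) ≡ (a ⊕ ∼ c) ∨ (a ⊕ ∼ d)
    ∼∧≡ = trans (∼∼ _) (cong₂ _∨_ (trans (∼∼ _) (⊕-comm _ a)) (trans (∼∼ _) (⊕-comm _ a)))
    a⊕∼c∨∼d⊕b≡𝟙 : (a ⊕ (∼ c ∨ ∼ d)) ⊕ b ≡ 𝟙
    a⊕∼c∨∼d⊕b≡𝟙 = begin
      (a ⊕ (∼ c ∨ ∼ d)) ⊕ b    ≡⟨ ⊕-assoc _ _ _ ⟩
      a ⊕ ((∼ c ∨ ∼ d) ⊕ b)    ≡⟨ x∙yz≈y∙xz _ _ _ ⟩
      (∼ c ∨ ∼ d) ⊕ (a ⊕ b)    ≡⟨ cong (_⊕ (a ⊕ b)) (∼∼ _) ⟨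
      ∼ (c ∧ d) ⊕ (a ⊕ b)      ≡⟨ c∧d≼a⊕b ⟩
      𝟙                        ∎
    𝟙≼ : 𝟙 ≼ ((a ⊕ ∼ c) ∨ (a ⊕ ∼ d)) ⊕ b
    𝟙≼ = subst (_≼ ((a ⊕ ∼ c) ∨ (a ⊕ ∼ d)) ⊕ b) a⊕∼c∨∼d⊕b≡𝟙
               (⊕-monoˡ-≼ b (⊕-distribˡ-∨-≼ a (∼ c) (∼ d)))

  x≼a⊕x⊖a : ∀ x a → x ≼ a ⊕ (x ⊖ a)
  x≼a⊕x⊖a x a = subst (x ≼_) (⊕-comm _ a) (x≼x∨y x a)

  ⊖∧⊖≼𝟘 : ∀ a b → (a ⊖ b) ∧ (b ⊖ a) ≼ 𝟘
  ⊖∧⊖≼𝟘 a b = trans (⊕-identityʳ _)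
    (trans (∼∼ _) (trans (cong₂ _∨_ (∼∼ _) (∼∼ _)) (prelinearity a b)))

module IdealSums {ℓ : Level} (A : MVAlgebra ℓ) where
  open MVTheory A
  open MVProperties A
  module PLI = IsPrimeLatticeIdeal
  module MVI = IsMVIdeal

  private variable P Q R : Pred Carrier ℓ

  ⊕̄-comm : (P ⊕̄ Q) ⊆ (Q ⊕̄ P)
  ⊕̄-comm (a , b , a∈P , b∈Q , c≤) = b , a , b∈Q , a∈P , subst (_ ≤_) (⊕-comm a b) c≤

  ⊕̄-assoc-⊆ : ((P ⊕̄ Q) ⊕̄ R) ⊆ (P ⊕̄ (Q ⊕̄ R))
  ⊕̄-assoc-⊆ (d , k , (a , b , a∈P , b∈Q , d≤) , k∈R , c≤) =
    a , b ⊕ k , a∈P , (b , k , b∈Q , k∈R , ≤-refl _) ,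
    ≤-trans c≤ (subst (_ ⊕ k ≤_) (⊕-assoc a b k) (⊕-monoˡ-≤ k d≤))

  ⊕̄-assoc-⊇ : (P ⊕̄ (Q ⊕̄ R)) ⊆ ((P ⊕̄ Q) ⊕̄ R)
  ⊕̄-assoc-⊇ (a , e , a∈P , (b , k , b∈Q , k∈R , e≤) , c≤) =
    a ⊕ b , k , (a , b , a∈P , b∈Q , ≤-refl _) , k∈R ,
    ≤-trans c≤ (subst (a ⊕ _ ≤_) (sym (⊕-assoc a b k)) (⊕-monoʳ-≤ a e≤))

  ⊕̄-monoʳ : Q ⊆ R → (P ⊕̄ Q) ⊆ (P ⊕̄ R)
  ⊕̄-monoʳ Q⊆R (a , b , a∈P , b∈Q , c≤) = a , b , a∈P , Q⊆R b∈Q , c≤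

  ⊆⊕̄ : P 𝟘 → Q ⊆ (P ⊕̄ Q)
  ⊆⊕̄ 𝟘∈P {b} b∈Q = 𝟘 , b , 𝟘∈P , b∈Q , subst (b ≤_) (sym (⊕-identityˡ b)) (≤-refl b)

  module _ {P Q : Pred Carrier ℓ}
           (P-prime : IsPrimeLatticeIdeal P) (Q-prime : IsPrimeLatticeIdeal Q) where

    ⊕̄-∨-closed : ∀ {c d} → (P ⊕̄ Q) c → (P ⊕̄ Q) d → (P ⊕̄ Q) (c ∨ d)
    ⊕̄-∨-closed (a₁ , b₁ , a₁∈P , b₁∈Q , c≤) (a₂ , b₂ , a₂∈P , b₂∈Q , d≤) =
      a₁ ∨ a₂ , b₁ ∨ b₂ , PLI.∨-closed P-prime a₁∈P a₂∈P , PLI.∨-closed Q-prime b₁∈Q b₂∈Q ,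
      ≼⇒≤ (∨-lub (≼-trans (≤⇒≼ c≤) (⊕-mono-≼ (x≼x∨y a₁ a₂) (x≼x∨y b₁ b₂)))
                 (≼-trans (≤⇒≼ d≤) (⊕-mono-≼ (y≼x∨y a₁ a₂) (y≼x∨y b₁ b₂))))

    ⊕̄-prime : ∀ {c d} → (P ⊕̄ Q) (c ∧ d) → (P ⊕̄ Q) c ⊎ (P ⊕̄ Q) d
    ⊕̄-prime {c} {d} (a , b , a∈P , b∈Q , c∧d≤)
      with PLI.prime Q-prime (PLI.downward Q-prime b∈Q (≼⇒≤ (∧≼⊕⇒∧⊖≼ a b c d (≤⇒≼ c∧d≤))))
    ... | inj₁ c⊖a∈Q = inj₁ (a , c ⊖ a , a∈P , c⊖a∈Q , ≼⇒≤ (x≼a⊕x⊖a c a))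
    ... | inj₂ d⊖a∈Q = inj₂ (a , d ⊖ a , a∈P , d⊖a∈Q , ≼⇒≤ (x≼a⊕x⊖a d a))

    ⊕̄-isPrimeLatticeIdeal : ¬ (P ⊕̄ Q) 𝟙 → IsPrimeLatticeIdeal (P ⊕̄ Q)
    ⊕̄-isPrimeLatticeIdeal 𝟙∉P⊕̄Q = record
      { zero∈    = 𝟘 , 𝟘 , PLI.zero∈ P-prime , PLI.zero∈ Q-prime , ≼⇒≤ (𝟘≼ _)
      ; downward = λ { (a , b , a∈P , b∈Q , c≤) d≤c → a , b , a∈P , b∈Q , ≤-trans d≤c c≤ }
      ; ∨-closed = ⊕̄-∨-closed
      ; proper   = λ everything → 𝟙∉P⊕̄Q (everything 𝟙)
      ; prime    = ⊕̄-prime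
      }

  module _ {P : Pred Carrier ℓ} where

    𝟙∉ : IsPrimeLatticeIdeal P → ¬ P 𝟙
    𝟙∉ P-prime 𝟙∈P = PLI.proper P-prime λ a → PLI.downward P-prime 𝟙∈P (≼⇒≤ (≼𝟙 a))

    isMVIdeal⇒⊕̄-closed : IsMVIdeal P → (P ⊕̄ P) ⊆ P
    isMVIdeal⇒⊕̄-closed P-ideal (a , b , a∈P , b∈P , c≤) =
      MVI.downward P-ideal (MVI.⊕-closed P-ideal a∈P b∈P) c≤

    ⊕̄-closed⇒isPrimeMVIdeal : IsPrimeLatticeIdeal P → (P ⊕̄ P) ⊆ P → IsPrimeMVIdeal P
    ⊕̄-closed⇒isPrimeMVIdeal P-prime closed = record
      { isMVIdeal = record
        { zero∈    = PLI.zero∈ P-prime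
        ; downward = PLI.downward P-prime
        ; ⊕-closed = λ a∈P b∈P → closed (_ , _ , a∈P , b∈P , ≤-refl _) }
      ; proper    = PLI.proper P-prime
      ; prime     = λ a b → PLI.prime P-prime
                              (PLI.downward P-prime (PLI.zero∈ P-prime) (≼⇒≤ (⊖∧⊖≼𝟘 a b)))
      }

  pointSum : ∀ x x' → Dom x x' → Pt
  pointSum x x' dom = record
    { I = I x ⊕̄ I x' ; prime = ⊕̄-isPrimeLatticeIdeal (prime x) (prime x') dom }

  Y⇒⊕̄-closed : ∀ {y} → Y y → (I y ⊕̄ I y) ⊆ I y
  Y⇒⊕̄-closed Yy = isMVIdeal⇒⊕̄-closed (IsPrimeMVIdeal.isMVIdeal Yy)

  ⊕̄-closed⇒Dom : ∀ {y} → (I y ⊕̄ I y) ⊆ I y → Dom y y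
  ⊕̄-closed⇒Dom {y} closed 𝟙∈ = 𝟙∉ (prime y) (closed 𝟙∈)

  Y⇔⊕̄-closed : ∀ y → Y y ⇔ (Dom y y × (I y ⊕̄ I y) ⊆ I y)
  Y⇔⊕̄-closed y = mk⇔ to from
    where
    to : Y y → Dom y y × (I y ⊕̄ I y) ⊆ I y
    to Yy = ⊕̄-closed⇒Dom {y} (Y⇒⊕̄-closed {y} Yy) , Y⇒⊕̄-closed {y} Yy
    from : Dom y y × (I y ⊕̄ I y) ⊆ I y → Y y
    from (_ , closed) = ⊕̄-closed⇒isPrimeMVIdeal (prime y) closed

  Y⇔⊕̄-idempotent : ∀ y → Y y ⇔ (Dom y y × (I y ⊕̄ I y) ≐ I y)
  Y⇔⊕̄-idempotent y = mk⇔ to from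
    where
    to : Y y → Dom y y × (I y ⊕̄ I y) ≐ I y
    to Yy = ⊕̄-closed⇒Dom {y} (Y⇒⊕̄-closed {y} Yy) , Y⇒⊕̄-closed {y} Yy ,
            ⊆⊕̄ {I y} (PLI.zero∈ (prime y))
    from : Dom y y × (I y ⊕̄ I y) ≐ I y → Y y
    from (_ , closed , _) = ⊕̄-closed⇒isPrimeMVIdeal (prime y) closed

module Topology {ℓ : Level} (em : ExcludedMiddle ℓ) (A : MVAlgebra ℓ) where
  open MVTheory A
  open IdealSums A

  dne : {P : Set ℓ} → ¬ ¬ P → P
  dne = em⇒dne em

  ∁hat-open : ∀ a → IsOpen↑ (∁ (hat a))
  ∁hat-open a _ a∈I = a , a∈I , id

  Nbhd↑² : ∀ {ℓ'} → Pred (Pt × Pt) ℓ' → Pt × Pt → Set (Level.suc ℓ Level.⊔ ℓ')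
  Nbhd↑² W p = Σ (Pred Pt ℓ) λ U → Σ (Pred Pt ℓ) λ V →
                 IsOpen↑ U × IsOpen↑ V × U (proj₁ p) × V (proj₂ p) ×
                 (∀ y y' → U y → V y' → W (y , y'))

  Nbhd↑²-mono : ∀ {ℓ' ℓ''} {W : Pred (Pt × Pt) ℓ'} {W' : Pred (Pt × Pt) ℓ''} {p} →
                W ⊆ W' → Nbhd↑² W p → Nbhd↑² W' p
  Nbhd↑²-mono W⊆W' (U , V , U-open , V-open , p₁∈U , p₂∈V , U×V⊆W) =
    U , V , U-open , V-open , p₁∈U , p₂∈V , λ y y' y∈U y'∈V → W⊆W' (U×V⊆W y y' y∈U y'∈V)

  ⊕̄∋-nbhd : ∀ {c p} → (I (proj₁ p) ⊕̄ I (proj₂ p)) c →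
            Nbhd↑² (λ q → (I (proj₁ q) ⊕̄ I (proj₂ q)) c) p
  ⊕̄∋-nbhd (a , b , a∈I , b∈I , c≤) =
    ∁ (hat a) , ∁ (hat b) , ∁hat-open a , ∁hat-open b , (λ a∉ → a∉ a∈I) , (λ b∉ → b∉ b∈I) ,
    λ y y' a∈I' b∈I' → a , b , dne a∈I' , dne b∈I' , c≤

  Dom-closed : IsClosed↑² DomP
  Dom-closed p ¬dom = Nbhd↑²-mono (λ 𝟙∈ dom → dom 𝟙∈) (⊕̄∋-nbhd (dne ¬dom))

  -- W is (X² ∖ dom(+)) ∪ +⁻¹ U: it agrees with +⁻¹ U on dom(+), and dom(+) is closed.
  +-continuous : ∀ U → IsOpen↑ U → IsOpenInDom (+⁻¹ U)
  +-continuous U U-open = W , W-open , λ p dom → mk⇔ (λ (_ , z) _ → z) (λ w → dom , w dom)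
    where
    W : Pred (Pt × Pt) (Level.suc ℓ)
    W p = DomP p → ∃ λ (z : Pt) → (I z ≐ (I (proj₁ p) ⊕̄ I (proj₂ p))) × U z
    W-open : IsOpen↑² W
    W-open p w with em {DomP p}
    ... | no ¬dom = Nbhd↑²-mono (λ ¬dom' dom' → ⊥-elim (¬dom' dom')) (Dom-closed p ¬dom)
    ... | yes dom with w dom
    ...   | z , z≐ , z∈U with U-open z z∈U
    ...     | c , c∈I , ∁ĉ⊆U =
      Nbhd↑²-mono (λ {q} c∈ dom' → pointSum (proj₁ q) (proj₂ q) dom' , ≐-refl , ∁ĉ⊆U λ c∉ → c∉ c∈)
                  (⊕̄∋-nbhd (proj₁ z≐ (dne c∈I)))

  ¬Y⇒⊕-escapes : ∀ {x} → ¬ Y x → ∃₂ λ a b → I x a × I x b × ¬ I x (a ⊕ b)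
  ¬Y⇒⊕-escapes {x} ¬Yx = dne λ none → ¬Yx (⊕̄-closed⇒isPrimeMVIdeal (prime x)
    λ (a , b , a∈I , b∈I , c≤) → PLI.downward (prime x)
                                   (dne λ a⊕b∉ → none (a , b , a∈I , b∈I , a⊕b∉)) c≤)

  Y-closed : IsClosedᵖ Y
  Y-closed x ¬Yx with ¬Y⇒⊕-escapes {x} ¬Yx
  ... | a , b , a∈I , b∈I , a⊕b∉I =
    (false , a) ∷ (false , b) ∷ (true , a ⊕ b) ∷ [] ,
    (λ a∉ → a∉ a∈I) ∷ (λ b∉ → b∉ b∈I) ∷ a⊕b∉I ∷ [] ,
    λ { y (a∈ ∷ b∈ ∷ a⊕b∉ ∷ []) Yy →
          a⊕b∉ (MVI.⊕-closed (IsPrimeMVIdeal.isMVIdeal Yy) (dne a∈) (dne b∈)) }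

proposition6p8 : {ℓ : Level} → ExcludedMiddle ℓ → (A : MVAlgebra ℓ) →
    let open MVTheory A in
    (∀ x x' → Dom x x' → Dom x' x × ((I x ⊕̄ I x') ≐ (I x' ⊕̄ I x)))
    × (∀ x x' x'' → Dom x x' → ¬ (((I x ⊕̄ I x') ⊕̄ I x'') 𝟙) →
    Dom x' x'' × ¬ ((I x ⊕̄ (I x' ⊕̄ I x'')) 𝟙)
    × (((I x ⊕̄ I x') ⊕̄ I x'') ≐ (I x ⊕̄ (I x' ⊕̄ I x''))))
    × (∀ x x' x'' → I x' ⊆ I x'' → Dom x x'' →
    Dom x x' × ((I x ⊕̄ I x') ⊆ (I x ⊕̄ I x'')))
    × (∀ x → IsPrimeMVIdeal (I x) ⇔ (Dom x x × ((I x ⊕̄ I x) ≐ I x)))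
    × (∀ y → (Y y ⇔ (Dom y y × ((I y ⊕̄ I y) ⊆ I y)))
    × (Y y ⇔ (Dom y y × ((I y ⊕̄ I y) ≐ I y))))
    × IsClosedᵖ Y
    × (∀ U → IsOpen↑ U → IsOpenInDom (+⁻¹ U))
    × IsClosed↑² DomP
proposition6p8 em A =
    (λ x x' dom → (λ 𝟙∈ → dom (⊕̄-comm 𝟙∈)) , ⊕̄-comm , ⊕̄-comm)
  , (λ x x' x'' _ dom₃ →
       (λ 𝟙∈ → dom₃ (⊕̄-assoc-⊇ (⊆⊕̄ (PLI.zero∈ (prime x)) 𝟙∈)))
     , (λ 𝟙∈ → dom₃ (⊕̄-assoc-⊇ 𝟙∈))
     , ⊕̄-assoc-⊆ , ⊕̄-assoc-⊇)
  , (λ x x' x'' x'⊆x'' dom → (λ 𝟙∈ → dom (⊕̄-monoʳ x'⊆x'' 𝟙∈)) , ⊕̄-monoʳ x'⊆x'')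
  , Y⇔⊕̄-idempotent
  , (λ y → Y⇔⊕̄-closed y , Y⇔⊕̄-idempotent y)
  , Y-closed
  , +-continuous
  , Dom-closed
  where
  open MVTheory A
  open IdealSums A
  open Topology em A
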